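{- Let $m\geqslant4$ be even and let $H$, $x$, $y$, $z$ be as in the context. Then $\langle x,y,z\rangle$ is transitive on $H^*=H\setminus\{1\}$.
   Context: Permutations act on the right, written exponentially, and a product $\sigma\rho$ means first $\sigma$ then $\rho$. Let $m\geqslant4$ be even and $H=\langle a,b\mid a^4=b^2=(ab)^2=1\rangle\times\langle c_1\rangle\times\cdots\times\langle c_{m-3}\rangle$, where $c_1,\dots,c_{m-3}$ are involutions. Put $c_{ -1}=c_0=1$. Let $K=\langle a^2,b,c_1,\dots,c_{m-3}\rangle$ and $h=a\prod_{i=0}^{(m-4)/2}c_{2i+1}$. Let $x\in\mathrm{Aut}(H)$ be defined by $a^x=a^{ -1}$, $b^x=ab$, $c_{2i+1}^x=c_{2i+1}$, $c_{2i+2}^x=a^2c_{2i+1}c_{2i+2}$ for $0\leqslant i\leqslant(m-6)/2$, and $c_{m-3}^x=a^2c_{m-3}$. Let $\tau\in\mathrm{Aut}(K)$ be defined by $(a^2)^\tau=b$, $b^\tau=a^2$, $c_{2i+1}^\tau=c_{2i-1}c_{2i}c_{2i+2}$, $c_{2i+2}^\tau=c_{2i-1}c_{2i}c_{2i+1}$ for $0\leqslant i\leqslant(m-6)/2$, and $c_{m-3}^\tau=c_{m-3}$. Let $R$ be the right regular representation of $H$ ($R(g):u\mapsto ug$). Let $y$ be the permutation of $H$ with $k^y=k^\tau$ and $(hk)^y=hk^\tau c_{m-3}$ for all $k\in K$, and $z=R(h)\,y\,R(h^{ -1}c_{m-3})$. -}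

module Defs where

open import Data.Nat using (ℕ; zero; suc; _+_; _*_; _∸_; _≡ᵇ_; _/_; _%_)
open import Data.Bool using (Bool; true; false; if_then_else_; _xor_; not)
open import Data.Fin using (Fin; toℕ)
open import Data.Vec using (Vec; replicate; zipWith; lookup; tabulate)
open import Data.List using (List; []; _∷_; foldr; map; upTo; allFin)
open import Data.Product using (Σ; _×_; _,_)
open import Relation.Binary.PropositionalEquality using (_≡_)
open import Relation.Binary.Construct.Closure.Equivalence using (EqClosure)

-- Z/4 (exponents of a)

data Z4 : Set where
  e0 e1 e2 e3 : Z4

_⊕_ : Z4 → Z4 → Z4
e0 ⊕ y = y
e1 ⊕ e0 = e1
e1 ⊕ e1 = e2
e1 ⊕ e2 = e3
e1 ⊕ e3 = e0
e2 ⊕ e0 = e2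
e2 ⊕ e1 = e3
e2 ⊕ e2 = e0
e2 ⊕ e3 = e1
e3 ⊕ e0 = e3
e3 ⊕ e1 = e0
e3 ⊕ e2 = e1
e3 ⊕ e3 = e2

neg : Z4 → Z4
neg e0 = e0
neg e1 = e3
neg e2 = e2
neg e3 = e1

-- H = <a,b | a^4 = b^2 = (ab)^2 = 1> × <c_1> × ... × <c_{m-3}>
-- An element mk i j v is the normal form a^i b^j c_1^{v_1} ... c_{m-3}^{v_{m-3}}
-- (the c-part v : Vec Bool (m ∸ 3), position t ↔ c_{t+1}).

data H (m : ℕ) : Set where
  mk : Z4 → Bool → Vec Bool (m ∸ 3) → H m

module _ {m : ℕ} where

  one : H m
  one = mk e0 false (replicate _ false)

  -- a^i b^j · a^k b^l = a^(i ± k) b^(j+l), using b a b = a^{-1}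
  _·_ : H m → H m → H m
  mk i j v · mk k l w =
    mk (i ⊕ (if j then neg k else k)) (j xor l) (zipWith _xor_ v w)

  inv : H m → H m
  inv (mk i false v) = mk (neg i) false v
  inv (mk i true v) = mk i true v

  prod : List (H m) → H m
  prod = foldr _·_ one

  a : H m
  a = mk e1 false (replicate _ false)

  b : H m
  b = mk e0 true (replicate _ false)

  -- c l = c_l for 1 ≤ l ≤ m-3, and c l = 1 otherwise (in particular c_0 = 1;
  -- the paper's c_{-1} = 1 arises below as c (l ∸ k) truncated at 0).
  c : ℕ → H m
  c l = mk e0 false (tabulate (λ t → suc (toℕ t) ≡ᵇ l))

  powZ4 : H m → Z4 → H m
  powZ4 g e0 = one
  powZ4 g e1 = g
  powZ4 g e2 = g · g
  powZ4 g e3 = g · (g · g)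

  powB : H m → Bool → H m
  powB g false = one
  powB g true = g

  isOdd : ℕ → Bool
  isOdd l = (l % 2) ≡ᵇ 1

  h : H m
  h = a · prod (map (λ i → c (2 * i + 1)) (upTo (suc ((m ∸ 4) / 2))))

  -- x ∈ Aut(H), given on generators and extended homomorphically:
  -- (a^i b^j ∏ c_l^{v_l})^x = (a^x)^i (b^x)^j ∏ (c_l^x)^{v_l}.

  xc : ℕ → H m
  xc l =
    if l ≡ᵇ (m ∸ 3) then (a · a) · c l
    else if isOdd l then c l
    else ((a · a) · c (l ∸ 1)) · c l

  xmap : H m → H m
  xmap (mk i j v) =
    powZ4 (inv a) i · (powB (a · b) j ·
      prod (map (λ t → powB (xc (suc (toℕ t))) (lookup v t)) (allFin (m ∸ 3))))

  -- τ ∈ Aut(K), K = <a^2, b, c_1, ..., c_{m-3}>, given on generators and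
  -- extended homomorphically: ((a^2)^e b^j ∏ c_l^{v_l})^τ = b^e (a^2)^j ∏ (c_l^τ)^{v_l}.
  -- Only applied to elements of K (a-exponent 0 or 2).

  inK : H m → Bool
  inK (mk e0 _ _) = true
  inK (mk e2 _ _) = true
  inK (mk _ _ _) = false

  isE2 : Z4 → Bool
  isE2 e2 = true
  isE2 _ = false

  τc : ℕ → H m
  τc l =
    if l ≡ᵇ (m ∸ 3) then c l
    else if isOdd l then (c (l ∸ 2) · c (l ∸ 1)) · c (l + 1)
    else (c (l ∸ 3) · c (l ∸ 2)) · c (l ∸ 1)

  τmap : H m → H m
  τmap (mk i j v) =
    powB b (isE2 i) · (powB (a · a) j ·
      prod (map (λ t → powB (τc (suc (toℕ t))) (lookup v t)) (allFin (m ∸ 3))))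

  -- y : k ↦ k^τ and hk ↦ h k^τ c_{m-3}  (k ∈ K); H = K ∪ hK.

  ymap : H m → H m
  ymap u = if inK u then τmap u else (h · τmap (inv h · u)) · c (m ∸ 3)

  R : H m → H m → H m
  R g u = u · g

  -- z = R(h) y R(h^{-1} c_{m-3}); permutations act on the right and
  -- products are composed left to right, so u^z = ((u h)^y) h^{-1} c_{m-3}.
  zmap : H m → H m
  zmap u = R (inv h · c (m ∸ 3)) (ymap (R h u))

data Gen : Set where
  gx gy gz : Gen

act : (m : ℕ) → Gen → H m → H m
act m gx = xmap {m}
act m gy = ymap {m}
act m gz = zmap {m}

Step : (m : ℕ) → H m → H m → Set
Step m u v = Σ Gen (λ g → act m g u ≡ v)

-- u and v lie in the same <x,y,z>-orbit: the equivalence closure of the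
-- generator steps (x, y, z are permutations of the finite set H, so this is
-- exactly the orbit relation of the generated group).
SameOrbit : (m : ℕ) → H m → H m → Set
SameOrbit m = EqClosure (Step m)

-- Write m = 2r + 4 and H = D₈ × V, V = ⟨c_1, …, c_{m-3}⟩ ≅ 𝔽₂^{2r+1}.  On normal forms
-- a^i b^j w (w ∈ V) the generators act by explicit affine formulas: x acts on V by a linear
-- map xᶜ and contributes a² according to a linear functional xᵃ; y acts on K by swapping a²
-- with b and applying a linear map τᶜ to V, and on the coset aK in the same way but with
-- τᶜ w + gᶜ in place of τᶜ w; z is similar.  Chasing the eight cosets of V shows that every
-- a^i b^j w with (i, j) ≠ (0, 0) lies in the orbit of some a w.  The vectors t with
-- a w ~ a (w + t) for all w form a subspace containing gᶜ and stable under xᶜ and τᶜ, which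
-- is all of V because gᶜ generates V as an ⟨xᶜ, τᶜ⟩-module; so all a w form one orbit.
-- Dually, the functionals φ for which φ w = 1 forces w into that orbit contain xᵃ and are
-- closed under sums and precomposition with xᶜ and τᶜ, hence contain every coordinate
-- functional, and so every w ≠ 0 is reached as well.

module Submission where

open import Algebra.Bundles using (CommutativeRing; CommutativeSemigroup)
open import Data.Bool using (Bool; true; false; _xor_; if_then_else_)
open import Data.Bool.Properties
  using (xor-assoc; xor-comm; xor-identityˡ; xor-identityʳ; xor-same; xor-∧-commutativeRing)
open import Data.Empty using (⊥-elim)
open import Data.Fin using (toℕ)
open import Data.List using (List; map; allFin; upTo; applyUpTo; foldr) renaming (tabulate to tabulateᴸ)
open import Data.List.Properties using (map-tabulate; map-applyUpTo)
open import Data.Nat using (ℕ; zero; suc; _+_; _*_; _∸_; _/_; _≡ᵇ_; _≤_; _<_; z≤n; s≤s)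
open import Data.Nat.DivMod using (m*n/n≡m)
open import Data.Nat.Divisibility using (_∣_; divides)
open import Data.Nat.Properties using (+-comm; *-comm; +-suc; ≤-refl; m≤n+m; m∸n+n≡m; <-trans; n<1+n)
open import Data.Product using (∃-syntax; _×_; _,_)
open import Data.Sum using (_⊎_; inj₁; inj₂)
open import Data.Vec using (Vec; []; _∷_; replicate; zipWith; tabulate; lookup)
open import Data.Vec.Properties using (zipWith-assoc; zipWith-comm; zipWith-identityˡ; zipWith-identityʳ)
open import Level using (0ℓ)
open import Relation.Binary.Bundles using (Setoid)
open import Relation.Binary.Construct.Closure.Equivalence using (return; setoid)
open import Relation.Binary.PropositionalEquality
  using (_≡_; _≢_; refl; sym; trans; cong; cong₂; subst; isEquivalence; module ≡-Reasoning)
import Relation.Binary.Reasoning.Setoid as SetoidReasoning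

open import Defs

private variable n r : ℕ

-- Vectors over 𝔽₂

open CommutativeRing xor-∧-commutativeRing using (+-commutativeSemigroup)
open import Algebra.Properties.CommutativeSemigroup +-commutativeSemigroup
  using () renaming (interchange to xor-interchange)

xor-cancelʳ : ∀ p q → (p xor q) xor q ≡ p
xor-cancelʳ p q = trans (xor-assoc p q q) (trans (cong (p xor_) (xor-same q)) (xor-identityʳ p))

xor-cancelˡ : ∀ p q → p xor (p xor q) ≡ q
xor-cancelˡ p q = trans (sym (xor-assoc p p q)) (cong (_xor q) (xor-same p))

infixl 6 _⊻_

_⊻_ : Vec Bool n → Vec Bool n → Vec Bool n
_⊻_ = zipWith _xor_

0ᵛ : Vec Bool n
0ᵛ = replicate _ false

⊻-assoc : (u v w : Vec Bool n) → (u ⊻ v) ⊻ w ≡ u ⊻ (v ⊻ w)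
⊻-assoc = zipWith-assoc xor-assoc

⊻-comm : (v w : Vec Bool n) → v ⊻ w ≡ w ⊻ v
⊻-comm = zipWith-comm xor-comm

⊻-identityˡ : (v : Vec Bool n) → 0ᵛ ⊻ v ≡ v
⊻-identityˡ = zipWith-identityˡ xor-identityˡ

⊻-identityʳ : (v : Vec Bool n) → v ⊻ 0ᵛ ≡ v
⊻-identityʳ = zipWith-identityʳ xor-identityʳ

⊻-self : (v : Vec Bool n) → v ⊻ v ≡ 0ᵛ
⊻-self []      = refl
⊻-self (x ∷ v) = cong₂ _∷_ (xor-same x) (⊻-self v)

⊻-cancelʳ : (u v : Vec Bool n) → (u ⊻ v) ⊻ v ≡ u
⊻-cancelʳ u v = trans (⊻-assoc u v v) (trans (cong (u ⊻_) (⊻-self v)) (⊻-identityʳ u))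

⊻-zerosˡ : ∀ {u u' v : Vec Bool n} → u ≡ 0ᵛ → u' ≡ 0ᵛ → u ⊻ (u' ⊻ v) ≡ v
⊻-zerosˡ {v = v} refl refl = trans (⊻-identityˡ _) (⊻-identityˡ v)

⊻-cancelˡ : (u v : Vec Bool n) → u ⊻ (u ⊻ v) ≡ v
⊻-cancelˡ u v = trans (sym (⊻-assoc u u v)) (trans (cong (_⊻ v) (⊻-self u)) (⊻-identityˡ v))

⊻-commutativeSemigroup : ℕ → CommutativeSemigroup 0ℓ 0ℓ
⊻-commutativeSemigroup n = record
  { Carrier                = Vec Bool n
  ; _≈_                    = _≡_
  ; _∙_                    = _⊻_
  ; isCommutativeSemigroup = record
    { isSemigroup = record
      { isMagma = record { isEquivalence = isEquivalence ; ∙-cong = cong₂ _⊻_ }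
      ; assoc   = ⊻-assoc
      }
    ; comm        = ⊻-comm
    }
  }

module _ {n : ℕ} where
  open import Algebra.Properties.CommutativeSemigroup (⊻-commutativeSemigroup n) public
    using (x∙yz≈z∙xy; x∙yz≈yx∙z; xy∙z≈xz∙y)

-- The j-th standard basis vector, counted from 0 (the c-part of c_{j+1}); 0ᵛ when j ≥ n.
unit : ℕ → Vec Bool n
unit {zero}  _       = []
unit {suc n} zero    = true ∷ 0ᵛ
unit {suc n} (suc j) = false ∷ unit j

⊻-induction : (P : Vec Bool n → Set) → P 0ᵛ → (∀ {v w} → P v → P w → P (v ⊻ w)) →
              (∀ j → j < n → P (unit j)) → ∀ v → P v
⊻-induction P P0 P⊻ Punit []      = P0
⊻-induction P P0 P⊻ Punit (x ∷ v) =
  subst P (cong₂ _∷_ (xor-identityʳ x) (⊻-identityˡ v)) (P⊻ (head x) tail)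
  where
  head : ∀ x → P (x ∷ 0ᵛ)
  head false = P0
  head true  = Punit zero (s≤s z≤n)
  tail : P (false ∷ v)
  tail = ⊻-induction (λ w → P (false ∷ w)) P0 P⊻ (λ j j<n → Punit (suc j) (s≤s j<n)) v

⊻-sum : List (Vec Bool n) → Vec Bool n
⊻-sum = foldr _⊻_ 0ᵛ

additive-0 : ∀ {k n} (φ : Vec Bool k → Vec Bool n) → (∀ v w → φ (v ⊻ w) ≡ φ v ⊻ φ w) → φ 0ᵛ ≡ 0ᵛ
additive-0 φ φ-⊻ = trans (cong φ (sym (⊻-self 0ᵛ))) (trans (φ-⊻ 0ᵛ 0ᵛ) (⊻-self (φ 0ᵛ)))

-- The c-part of H and the maps induced by x and τ

double : ℕ → ℕ
double zero    = zero
double (suc r) = suc (suc (double r))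

double-*2 : ∀ r → double r ≡ r * 2
double-*2 zero    = refl
double-*2 (suc r) = cong (λ n → suc (suc n)) (double-*2 r)

double-/2 : ∀ r → double r / 2 ≡ r
double-/2 r = trans (cong (_/ 2) (double-*2 r)) (m*n/n≡m r 2)

2*+1≡suc-double : ∀ i → 2 * i + 1 ≡ suc (double i)
2*+1≡suc-double i = trans (+-comm (2 * i) 1) (cong suc (trans (*-comm 2 i) (sym (double-*2 i))))

≡ᵇ-refl : ∀ n → (n ≡ᵇ n) ≡ true
≡ᵇ-refl zero    = refl
≡ᵇ-refl (suc n) = ≡ᵇ-refl n

double-≡ᵇ-< : ∀ {k r} → k < r → (double k ≡ᵇ double r) ≡ false
double-≡ᵇ-< {zero}  {suc r} _         = refl
double-≡ᵇ-< {suc k} {suc r} (s≤s k<r) = double-≡ᵇ-< k<r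

odd-≡ᵇ-double : ∀ k r → (suc (double k) ≡ᵇ double r) ≡ false
odd-≡ᵇ-double k       zero    = refl
odd-≡ᵇ-double zero    (suc r) = refl
odd-≡ᵇ-double (suc k) (suc r) = odd-≡ᵇ-double k r

-- The c-part of an element of H (4 + 2r): r pairs (c_{2k+1}, c_{2k+2}), then c_{2r+1} = c_{m-3}.
-- double is recursive so that CPart (suc r) unfolds to Bool ∷ Bool ∷ CPart r.
CPart : ℕ → Set
CPart r = Vec Bool (suc (double r))

cpart-indices : (Q : ℕ → Set) → (∀ k → k < r → Q (double k)) →
                (∀ k → k < r → Q (suc (double k))) → Q (double r) →
                ∀ j → j < suc (double r) → Q j
cpart-indices {zero}  Q Qp Qq Qlast zero          _               = Qlast
cpart-indices {zero}  Q Qp Qq Qlast (suc j)       (s≤s ())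
cpart-indices {suc r} Q Qp Qq Qlast zero          _               = Qp zero (s≤s z≤n)
cpart-indices {suc r} Q Qp Qq Qlast (suc zero)    _               = Qq zero (s≤s z≤n)
cpart-indices {suc r} Q Qp Qq Qlast (suc (suc j)) (s≤s (s≤s j<)) =
  cpart-indices (λ j → Q (suc (suc j))) (λ k k<r → Qp (suc k) (s≤s k<r))
    (λ k k<r → Qq (suc k) (s≤s k<r)) Qlast j j<

-- x sends the c-part w to a^{2 xᵃ w} · xᶜ w, since c_{2k+2}^x = a² c_{2k+1} c_{2k+2} and
-- c_{m-3}^x = a² c_{m-3}.  τ sends it to τᶜ w; as c_{2i+1}^τ and c_{2i+2}^τ both contain
-- c_{2i-1} c_{2i}, each pair passes its carry p + q to the pair before it.
carry : CPart r → Bool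
carry {zero}  _           = false
carry {suc r} (p ∷ q ∷ _) = p xor q

xᶜ : CPart r → CPart r
xᶜ {zero}  v           = v
xᶜ {suc r} (p ∷ q ∷ w) = (p xor q) ∷ q ∷ xᶜ w

xᵃ : CPart r → Bool
xᵃ {zero}  (t ∷ [])    = t
xᵃ {suc r} (p ∷ q ∷ w) = q xor xᵃ w

τᶜ : CPart r → CPart r
τᶜ {zero}  v           = v
τᶜ {suc r} (p ∷ q ∷ w) = (q xor carry w) ∷ (p xor carry w) ∷ τᶜ w

carry-⊻ : (v w : CPart r) → carry (v ⊻ w) ≡ carry v xor carry w
carry-⊻ {zero}  _             _               = refl
carry-⊻ {suc r} (p ∷ q ∷ _) (p' ∷ q' ∷ _) = xor-interchange p p' q q'

xᶜ-⊻ : (v w : CPart r) → xᶜ (v ⊻ w) ≡ xᶜ v ⊻ xᶜ w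
xᶜ-⊻ {zero}  _             _               = refl
xᶜ-⊻ {suc r} (p ∷ q ∷ v) (p' ∷ q' ∷ w) =
  cong₂ _∷_ (xor-interchange p p' q q') (cong ((q xor q') ∷_) (xᶜ-⊻ v w))

xᵃ-⊻ : (v w : CPart r) → xᵃ (v ⊻ w) ≡ xᵃ v xor xᵃ w
xᵃ-⊻ {zero}  (t ∷ [])    (t' ∷ [])      = refl
xᵃ-⊻ {suc r} (p ∷ q ∷ v) (p' ∷ q' ∷ w) =
  trans (cong ((q xor q') xor_) (xᵃ-⊻ v w)) (xor-interchange q q' (xᵃ v) (xᵃ w))

τᶜ-⊻ : (v w : CPart r) → τᶜ (v ⊻ w) ≡ τᶜ v ⊻ τᶜ w
τᶜ-⊻ {zero}  _             _               = refl
τᶜ-⊻ {suc r} (p ∷ q ∷ v) (p' ∷ q' ∷ w) =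
  cong₂ _∷_ (shift q q') (cong₂ _∷_ (shift p p') (τᶜ-⊻ v w))
  where
  shift : ∀ x x' → (x xor x') xor carry (v ⊻ w) ≡ (x xor carry v) xor (x' xor carry w)
  shift x x' = trans (cong ((x xor x') xor_) (carry-⊻ v w)) (xor-interchange x x' _ _)

xᶜ-involutive : (w : CPart r) → xᶜ (xᶜ w) ≡ w
xᶜ-involutive {zero}  _           = refl
xᶜ-involutive {suc r} (p ∷ q ∷ w) = cong₂ _∷_ (xor-cancelʳ p q) (cong (q ∷_) (xᶜ-involutive w))

carry-τᶜ : (w : CPart r) → carry (τᶜ w) ≡ carry w
carry-τᶜ {zero}  _           = refl
carry-τᶜ {suc r} (p ∷ q ∷ w) = begin
  (q xor carry w) xor (p xor carry w) ≡⟨ xor-interchange q (carry w) p (carry w) ⟩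
  (q xor p) xor (carry w xor carry w) ≡⟨ cong ((q xor p) xor_) (xor-same (carry w)) ⟩
  (q xor p) xor false                 ≡⟨ xor-identityʳ (q xor p) ⟩
  q xor p                             ≡⟨ xor-comm q p ⟩
  p xor q                             ∎
  where open ≡-Reasoning

τᶜ-involutive : (w : CPart r) → τᶜ (τᶜ w) ≡ w
τᶜ-involutive {zero}  _           = refl
τᶜ-involutive {suc r} (p ∷ q ∷ w) rewrite carry-τᶜ w =
  cong₂ _∷_ (xor-cancelʳ p (carry w)) (cong₂ _∷_ (xor-cancelʳ q (carry w)) (τᶜ-involutive w))

carry-0 : carry {r} 0ᵛ ≡ false
carry-0 {zero}  = refl
carry-0 {suc r} = refl

xᶜ-0 : xᶜ {r} 0ᵛ ≡ 0ᵛ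
xᶜ-0 {zero}  = refl
xᶜ-0 {suc r} = cong (λ v → false ∷ false ∷ v) xᶜ-0

xᵃ-0 : xᵃ {r} 0ᵛ ≡ false
xᵃ-0 {zero}  = refl
xᵃ-0 {suc r} = xᵃ-0 {r}

τᶜ-0 : τᶜ {r} 0ᵛ ≡ 0ᵛ
τᶜ-0 {zero}  = refl
τᶜ-0 {suc r} rewrite carry-0 {r} = cong (λ v → false ∷ false ∷ v) τᶜ-0

xᶜ-unit-even : ∀ k → xᶜ {r} (unit (double k)) ≡ unit (double k)
xᶜ-unit-even {zero}  k       = refl
xᶜ-unit-even {suc r} zero    = cong (λ v → true ∷ false ∷ v) xᶜ-0
xᶜ-unit-even {suc r} (suc k) = cong (λ v → false ∷ false ∷ v) (xᶜ-unit-even k)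

xᶜ-unit-odd : ∀ {k} → k < r → xᶜ {r} (unit (suc (double k))) ≡ unit (double k) ⊻ unit (suc (double k))
xᶜ-unit-odd {suc r} {zero}  _         = cong (λ v → true ∷ true ∷ v) (trans xᶜ-0 (sym (⊻-self 0ᵛ)))
xᶜ-unit-odd {suc r} {suc k} (s≤s k<r) = cong (λ v → false ∷ false ∷ v) (xᶜ-unit-odd k<r)

xᵃ-unit-even : ∀ {k} → k < r → xᵃ {r} (unit (double k)) ≡ false
xᵃ-unit-even {suc r} {zero}  _         = xᵃ-0 {r}
xᵃ-unit-even {suc r} {suc k} (s≤s k<r) = xᵃ-unit-even k<r

xᵃ-unit-odd : ∀ {k} → k < r → xᵃ {r} (unit (suc (double k))) ≡ true
xᵃ-unit-odd {suc r} {zero}  _         = cong (true xor_) (xᵃ-0 {r})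
xᵃ-unit-odd {suc r} {suc k} (s≤s k<r) = xᵃ-unit-odd k<r

xᵃ-unit-last : xᵃ {r} (unit (double r)) ≡ true
xᵃ-unit-last {zero}  = refl
xᵃ-unit-last {suc r} = xᵃ-unit-last {r}

τᶜ-unit-last : τᶜ {r} (unit (double r)) ≡ unit (double r)
τᶜ-unit-last {zero}        = refl
τᶜ-unit-last {suc zero}    = refl
τᶜ-unit-last {suc (suc r)} = cong (λ v → false ∷ false ∷ v) (τᶜ-unit-last {suc r})

τᶜ-unit-0 : 0 < r → τᶜ {r} (unit 0) ≡ unit 1
τᶜ-unit-0 {suc r} _ rewrite carry-0 {r} = cong (λ v → false ∷ true ∷ v) τᶜ-0

τᶜ-unit-1 : 0 < r → τᶜ {r} (unit 1) ≡ unit 0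
τᶜ-unit-1 {suc r} _ rewrite carry-0 {r} = cong (λ v → true ∷ false ∷ v) τᶜ-0

τᶜ-unit-even : ∀ {k} → suc k < r → τᶜ {r} (unit (double (suc k))) ≡
               (unit (double k) ⊻ unit (suc (double k))) ⊻ unit (suc (double (suc k)))
τᶜ-unit-even {suc zero}    {zero}  (s≤s ())
τᶜ-unit-even {suc (suc r)} {zero}  _ rewrite carry-0 {r} =
  cong (λ v → true ∷ true ∷ false ∷ true ∷ v) (trans τᶜ-0 (sym (⊻-cancelʳ 0ᵛ 0ᵛ)))
τᶜ-unit-even {suc (suc r)} {suc k} (s≤s k<r) = cong (λ v → false ∷ false ∷ v) (τᶜ-unit-even k<r)

τᶜ-unit-odd : ∀ {k} → suc k < r → τᶜ {r} (unit (suc (double (suc k)))) ≡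
              (unit (double k) ⊻ unit (suc (double k))) ⊻ unit (double (suc k))
τᶜ-unit-odd {suc zero}    {zero}  (s≤s ())
τᶜ-unit-odd {suc (suc r)} {zero}  _ rewrite carry-0 {r} =
  cong (λ v → true ∷ true ∷ true ∷ false ∷ v) (trans τᶜ-0 (sym (⊻-cancelʳ 0ᵛ 0ᵛ)))
τᶜ-unit-odd {suc (suc r)} {suc k} (s≤s k<r) = cong (λ v → false ∷ false ∷ v) (τᶜ-unit-odd k<r)

unit-even-descent : ∀ {k} → suc k < r →
  (unit (double (suc k)) ⊻ τᶜ (unit (double (suc k)))) ⊻ xᶜ (τᶜ (unit (double (suc k))))
    ≡ unit {suc (double r)} (double k)
unit-even-descent {suc zero}    {zero}  (s≤s ())
unit-even-descent {suc (suc r)} {zero}  _ rewrite carry-0 {r} | τᶜ-0 {r} | xᶜ-0 {r} =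
  cong (λ v → true ∷ false ∷ false ∷ false ∷ v) (⊻-cancelʳ 0ᵛ 0ᵛ)
unit-even-descent {suc (suc r)} {suc k} (s≤s k<r) = cong (λ v → false ∷ false ∷ v) (unit-even-descent k<r)

-- The c-part of h.
oᶜ : CPart r
oᶜ {zero}  = true ∷ []
oᶜ {suc r} = true ∷ false ∷ oᶜ

-- y maps the c-part w of an element of aK to τᶜ w ⊻ gᶜ (y-hK); gᶜ-from-oᶜ computes gᶜ from h.
gᶜ : CPart r
gᶜ {zero}        = true ∷ []
gᶜ {suc zero}    = true ∷ true ∷ true ∷ []
gᶜ {suc (suc r)} = false ∷ false ∷ gᶜ

gᶜ-from-oᶜ : (oᶜ ⊻ τᶜ oᶜ) ⊻ unit (double r) ≡ gᶜ {r}
gᶜ-from-oᶜ {zero}        = refl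
gᶜ-from-oᶜ {suc zero}    = refl
gᶜ-from-oᶜ {suc (suc r)} = cong (λ v → false ∷ false ∷ v) (gᶜ-from-oᶜ {suc r})

τᶜ-gᶜ : τᶜ (gᶜ {r}) ≡ gᶜ
τᶜ-gᶜ {zero}              = refl
τᶜ-gᶜ {suc zero}          = refl
τᶜ-gᶜ {suc (suc zero)}    = refl
τᶜ-gᶜ {suc (suc (suc r))} = cong (λ v → false ∷ false ∷ v) (τᶜ-gᶜ {suc (suc r)})

τᶜ-τᶜ-⊻gᶜ : (w : CPart r) → τᶜ (τᶜ w ⊻ gᶜ) ≡ w ⊻ gᶜ
τᶜ-τᶜ-⊻gᶜ w = trans (τᶜ-⊻ (τᶜ w) gᶜ) (cong₂ _⊻_ (τᶜ-involutive w) τᶜ-gᶜ)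

τᶜ-⊻gᶜ-involutive : (w : CPart r) → τᶜ (τᶜ w ⊻ gᶜ) ⊻ gᶜ ≡ w
τᶜ-⊻gᶜ-involutive w = trans (cong (_⊻ gᶜ) (τᶜ-τᶜ-⊻gᶜ w)) (⊻-cancelʳ w gᶜ)

⊻-sum-shift : ∀ (f : ℕ → ℕ) s →
  ⊻-sum (applyUpTo (λ i → unit {suc (suc n)} (suc (suc (f i)))) s)
    ≡ false ∷ false ∷ ⊻-sum (applyUpTo (λ i → unit (f i)) s)
⊻-sum-shift f zero    = refl
⊻-sum-shift f (suc s) = cong (unit (suc (suc (f 0))) ⊻_) (⊻-sum-shift (λ i → f (suc i)) s)

oᶜ-sum : ⊻-sum (applyUpTo (λ i → unit (double i)) (suc r)) ≡ oᶜ {r}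
oᶜ-sum {zero}  = refl
oᶜ-sum {suc r} = begin
  unit 0 ⊻ ⊻-sum (applyUpTo (λ i → unit (double (suc i))) (suc r))
    ≡⟨ cong (unit 0 ⊻_) (⊻-sum-shift double (suc r)) ⟩
  true ∷ false ∷ (0ᵛ ⊻ ⊻-sum (applyUpTo (λ i → unit (double i)) (suc r)))
    ≡⟨ cong (λ v → true ∷ false ∷ v) (trans (⊻-identityˡ _) (oᶜ-sum {r})) ⟩
  true ∷ false ∷ oᶜ ∎
  where open ≡-Reasoning

y-hK-cpart : (w : CPart r) → (oᶜ ⊻ τᶜ (oᶜ ⊻ w)) ⊻ unit (double r) ≡ τᶜ w ⊻ gᶜ
y-hK-cpart w = begin
  (oᶜ ⊻ τᶜ (oᶜ ⊻ w)) ⊻ unit _    ≡⟨ cong (λ v → (oᶜ ⊻ v) ⊻ unit _) (τᶜ-⊻ oᶜ w) ⟩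
  (oᶜ ⊻ (τᶜ oᶜ ⊻ τᶜ w)) ⊻ unit _ ≡⟨ cong (_⊻ unit _) (x∙yz≈z∙xy oᶜ (τᶜ oᶜ) (τᶜ w)) ⟩
  (τᶜ w ⊻ (oᶜ ⊻ τᶜ oᶜ)) ⊻ unit _ ≡⟨ ⊻-assoc (τᶜ w) _ _ ⟩
  τᶜ w ⊻ ((oᶜ ⊻ τᶜ oᶜ) ⊻ unit _) ≡⟨ cong (τᶜ w ⊻_) gᶜ-from-oᶜ ⟩
  τᶜ w ⊻ gᶜ                      ∎
  where open ≡-Reasoning

z-ab-cpart : (w : CPart r) → τᶜ (w ⊻ oᶜ) ⊻ (oᶜ ⊻ unit (double r)) ≡ τᶜ w ⊻ gᶜ
z-ab-cpart w = begin
  τᶜ (w ⊻ oᶜ) ⊻ (oᶜ ⊻ unit _)      ≡⟨ cong (_⊻ (oᶜ ⊻ unit _)) (τᶜ-⊻ w oᶜ) ⟩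
  (τᶜ w ⊻ τᶜ oᶜ) ⊻ (oᶜ ⊻ unit _)   ≡⟨ ⊻-assoc (τᶜ w) _ _ ⟩
  τᶜ w ⊻ (τᶜ oᶜ ⊻ (oᶜ ⊻ unit _))   ≡⟨ cong (τᶜ w ⊻_) (x∙yz≈yx∙z (τᶜ oᶜ) oᶜ (unit _)) ⟩
  τᶜ w ⊻ ((oᶜ ⊻ τᶜ oᶜ) ⊻ unit _)   ≡⟨ cong (τᶜ w ⊻_) gᶜ-from-oᶜ ⟩
  τᶜ w ⊻ gᶜ                        ∎
  where open ≡-Reasoning

z-K-cpart : (w : CPart r) → (τᶜ (w ⊻ oᶜ) ⊻ gᶜ) ⊻ (oᶜ ⊻ unit (double r)) ≡ τᶜ w
z-K-cpart w = begin
  (τᶜ (w ⊻ oᶜ) ⊻ gᶜ) ⊻ (oᶜ ⊻ unit _) ≡⟨ xy∙z≈xz∙y (τᶜ (w ⊻ oᶜ)) gᶜ _ ⟩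
  (τᶜ (w ⊻ oᶜ) ⊻ (oᶜ ⊻ unit _)) ⊻ gᶜ ≡⟨ cong (_⊻ gᶜ) (z-ab-cpart w) ⟩
  (τᶜ w ⊻ gᶜ) ⊻ gᶜ                   ≡⟨ ⊻-cancelʳ (τᶜ w) gᶜ ⟩
  τᶜ w                               ∎
  where open ≡-Reasoning

gᶜ-descent : gᶜ {suc r} ⊻ xᶜ gᶜ ≡ unit (double r)
gᶜ-descent {zero}  = refl
gᶜ-descent {suc r} = cong (λ v → false ∷ false ∷ v) (gᶜ-descent {r})

unit-last-from-gᶜ : ∀ r → (unit (double r) ≡ gᶜ {r}) ⊎
                    ∃[ k ] (k < r × unit (double r) ≡ (gᶜ {r} ⊻ unit (double k)) ⊻ unit (suc (double k)))
unit-last-from-gᶜ zero    = inj₁ refl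
unit-last-from-gᶜ (suc r) = inj₂ (r , ≤-refl , sym (go r))
  where
  go : ∀ r → (gᶜ {suc r} ⊻ unit (double r)) ⊻ unit (suc (double r))
           ≡ unit {suc (double (suc r))} (double (suc r))
  go zero    = refl
  go (suc r) = cong (λ v → false ∷ false ∷ v) (go r)

unit-odd-ascent : ∀ {k} → suc k < r → unit {suc (double r)} (suc (double (suc k))) ≡
                  (unit (double k) ⊻ unit (suc (double k))) ⊻ τᶜ (unit (double (suc k)))
unit-odd-ascent {k = k} k<r = begin
  unit (suc (double (suc k)))                   ≡⟨ sym (⊻-cancelˡ u _) ⟩
  u ⊻ (u ⊻ unit (suc (double (suc k))))         ≡⟨ cong (u ⊻_) (sym (τᶜ-unit-even k<r)) ⟩
  u ⊻ τᶜ (unit (double (suc k)))                ∎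
  where
  open ≡-Reasoning
  u : CPart r
  u = unit (double k) ⊻ unit (suc (double k))

-- gᶜ ⊻ xᶜ gᶜ is the last p-unit; unit-even-descent walks down the p-units, each q-unit
-- comes from τᶜ of a p-unit, and the last unit from gᶜ and the last pair.
gᶜ-cyclic : (S : CPart r → Set) → S gᶜ → (∀ {v w} → S v → S w → S (v ⊻ w)) →
            (∀ {v} → S v → S (xᶜ v)) → (∀ {v} → S v → S (τᶜ v)) → ∀ v → S v
gᶜ-cyclic {r} S Sg S⊻ Sx Sτ = ⊻-induction S S0 S⊻ (cpart-indices (λ j → S (unit j)) S-even S-odd S-last)
  where
  S0 : S 0ᵛ
  S0 = subst S (⊻-self gᶜ) (S⊻ Sg Sg)

  descent : ∀ d k → d + suc k ≡ r → S (unit (double k))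
  descent zero    k refl = subst S gᶜ-descent (S⊻ Sg (Sx Sg))
  descent (suc d) k eq   = subst S (unit-even-descent k+1<r) (S⊻ (S⊻ S-next (Sτ S-next)) (Sx (Sτ S-next)))
    where
    S-next : S (unit (double (suc k)))
    S-next = descent d (suc k) (trans (+-suc d (suc k)) eq)
    k+1<r : suc k < r
    k+1<r = subst (suc (suc k) ≤_) eq (s≤s (m≤n+m (suc k) d))

  S-even : ∀ k → k < r → S (unit (double k))
  S-even k k<r = descent (r ∸ suc k) k (m∸n+n≡m k<r)

  S-odd : ∀ k → k < r → S (unit (suc (double k)))
  S-odd zero    0<r = subst S (τᶜ-unit-0 0<r) (Sτ (S-even 0 0<r))
  S-odd (suc k) k<r = subst S (sym (unit-odd-ascent k<r))
    (S⊻ (S⊻ (S-even k (<-trans (n<1+n k) k<r)) (S-odd k (<-trans (n<1+n k) k<r))) (Sτ (S-even (suc k) k<r)))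

  S-last : S (unit (double r))
  S-last with unit-last-from-gᶜ r
  ... | inj₁ eq             = subst S (sym eq) Sg
  ... | inj₂ (k , k<r , eq) = subst S (sym eq) (S⊻ (S⊻ Sg (S-even k k<r)) (S-odd k k<r))

-- The coordinates of the k-th pair; false beyond the r pairs, so never the last coordinate.
pAt qAt : ℕ → CPart r → Bool
pAt {zero}  _       _           = false
pAt {suc r} zero    (p ∷ _ ∷ _) = p
pAt {suc r} (suc k) (_ ∷ _ ∷ w) = pAt k w
qAt {zero}  _       _           = false
qAt {suc r} zero    (_ ∷ q ∷ _) = q
qAt {suc r} (suc k) (_ ∷ _ ∷ w) = qAt k w

pairSum : ℕ → CPart r → Bool
pairSum k w = pAt k w xor qAt k w

carry-pairSum : (w : CPart r) → carry w ≡ pairSum 0 w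
carry-pairSum {zero}  _           = refl
carry-pairSum {suc r} (p ∷ q ∷ w) = refl

xᵃ-xor-xᵃ-τᶜ : (w : CPart r) → xᵃ w xor xᵃ (τᶜ w) ≡ pairSum 0 w
xᵃ-xor-xᵃ-τᶜ {zero}  (t ∷ [])    = xor-same t
xᵃ-xor-xᵃ-τᶜ {suc r} (p ∷ q ∷ w) = begin
  (q xor xᵃ w) xor ((p xor carry w) xor xᵃ (τᶜ w)) ≡⟨ xor-interchange q (xᵃ w) _ _ ⟩
  (q xor (p xor carry w)) xor (xᵃ w xor xᵃ (τᶜ w))
    ≡⟨ cong ((q xor (p xor carry w)) xor_) (trans (xᵃ-xor-xᵃ-τᶜ w) (sym (carry-pairSum w))) ⟩
  (q xor (p xor carry w)) xor carry w              ≡⟨ cong (_xor carry w) (sym (xor-assoc q p (carry w))) ⟩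
  ((q xor p) xor carry w) xor carry w              ≡⟨ xor-cancelʳ (q xor p) (carry w) ⟩
  q xor p                                          ≡⟨ xor-comm q p ⟩
  p xor q                                          ∎
  where open ≡-Reasoning

pairSum-xᶜ : ∀ k (w : CPart r) → pairSum k (xᶜ w) ≡ pAt k w
pairSum-xᶜ {zero}  k       _           = refl
pairSum-xᶜ {suc r} zero    (p ∷ q ∷ _) = xor-cancelʳ p q
pairSum-xᶜ {suc r} (suc k) (_ ∷ _ ∷ w) = pairSum-xᶜ k w

pAt-τᶜ : ∀ k (w : CPart r) → pAt k (τᶜ w) ≡ qAt k w xor pairSum (suc k) w
pAt-τᶜ {zero}  k       _           = refl
pAt-τᶜ {suc r} zero    (_ ∷ q ∷ w) = cong (q xor_) (carry-pairSum w)
pAt-τᶜ {suc r} (suc k) (_ ∷ _ ∷ w) = pAt-τᶜ k w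

nonzero-cpart : (w : CPart r) → w ≢ 0ᵛ →
  (∃[ k ] pAt k w ≡ true) ⊎ (∃[ k ] qAt k w ≡ true) ⊎ xᵃ w ≡ true
nonzero-cpart {zero}  (true  ∷ [])        _   = inj₂ (inj₂ refl)
nonzero-cpart {zero}  (false ∷ [])        w≢0 = ⊥-elim (w≢0 refl)
nonzero-cpart {suc r} (true  ∷ _    ∷ _) _   = inj₁ (0 , refl)
nonzero-cpart {suc r} (false ∷ true ∷ _) _   = inj₂ (inj₁ (0 , refl))
nonzero-cpart {suc r} (false ∷ false ∷ w) w≢0
  with nonzero-cpart w (λ w≡0 → w≢0 (cong (λ v → false ∷ false ∷ v) w≡0))
... | inj₁ (k , pk)        = inj₁ (suc k , pk)
... | inj₂ (inj₁ (k , qk)) = inj₂ (inj₁ (suc k , qk))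
... | inj₂ (inj₂ xᵃw)      = inj₂ (inj₂ xᵃw)

module _ (G : (CPart r → Bool) → Set) (G-xᵃ : G xᵃ)
         (G-xor : ∀ {φ ψ} → G φ → G ψ → G (λ w → φ w xor ψ w))
         (G-∘xᶜ : ∀ {φ} → G φ → G (λ w → φ (xᶜ w))) (G-∘τᶜ : ∀ {φ} → G φ → G (λ w → φ (τᶜ w)))
         (G-ext : ∀ {φ ψ} → (∀ w → φ w ≡ ψ w) → G φ → G ψ) where

  G-pairSum : ∀ k → G (pairSum k)
  G-pAt     : ∀ k → G (pAt k)
  G-qAt     : ∀ k → G (qAt k)
  G-pairSum zero    = G-ext xᵃ-xor-xᵃ-τᶜ (G-xor G-xᵃ (G-∘τᶜ G-xᵃ))
  G-pairSum (suc k) = G-ext (λ w → trans (cong (_xor qAt k w) (pAt-τᶜ k w)) (xor-cancel-swap (qAt k w) _))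
                            (G-xor (G-∘τᶜ (G-pAt k)) (G-qAt k))
    where
    xor-cancel-swap : ∀ q d → (q xor d) xor q ≡ d
    xor-cancel-swap q d = trans (cong (_xor q) (xor-comm q d)) (xor-cancelʳ d q)
  G-pAt k = G-ext (pairSum-xᶜ k) (G-∘xᶜ (G-pairSum k))
  G-qAt k = G-ext (λ w → xor-cancelˡ (pAt k w) (qAt k w)) (G-xor (G-pAt k) (G-pairSum k))

  xᵃ-separates : ∀ w → w ≢ 0ᵛ → ∃[ φ ] (G φ × φ w ≡ true)
  xᵃ-separates w w≢0 with nonzero-cpart w w≢0
  ... | inj₁ (k , pk)        = pAt k , G-pAt k , pk
  ... | inj₂ (inj₁ (k , qk)) = qAt k , G-qAt k , qk
  ... | inj₂ (inj₂ xᵃw)      = xᵃ , G-xᵃ , xᵃw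

-- Normal forms of x, y and z

sq : Bool → Z4
sq s = if s then e2 else e0

sq-xor : ∀ s s' → sq s ⊕ sq s' ≡ sq (s xor s')
sq-xor false s'   = refl
sq-xor true  false = refl
sq-xor true  true  = refl

⊕-identityʳ : ∀ i → i ⊕ e0 ≡ i
⊕-identityʳ e0 = refl
⊕-identityʳ e1 = refl
⊕-identityʳ e2 = refl
⊕-identityʳ e3 = refl

module _ {m : ℕ} where

  -- The central subgroup ⟨a², c_1, …, c_{m-3}⟩, with the a²-exponent as first coordinate.
  central : Vec Bool (suc (m ∸ 3)) → H m
  central (s ∷ v) = mk (sq s) false v

  central-· : ∀ u v → central u · central v ≡ central (u ⊻ v)
  central-· (s ∷ u) (s' ∷ v) = cong (λ i → mk i false (u ⊻ v)) (sq-xor s s')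

  one-· : ∀ (u : H m) → one · u ≡ u
  one-· (mk i j v) = cong (mk i j) (⊻-identityˡ v)

  ·-c : ∀ i j (v u : Vec Bool (m ∸ 3)) → mk {m} i j v · mk e0 false u ≡ mk i j (v ⊻ u)
  ·-c i false v u = cong₂ (λ i' j' → mk i' j' (v ⊻ u)) (⊕-identityʳ i) refl
  ·-c i true  v u = cong₂ (λ i' j' → mk i' j' (v ⊻ u)) (⊕-identityʳ i) refl

  c-unit : ∀ j → c {m} (suc j) ≡ mk e0 false (unit j)
  c-unit j = cong (mk e0 false) (tabulate-≡ᵇ j)
    where
    tabulate-≡ᵇ : ∀ {n} j → tabulate {n = n} (λ t → suc (toℕ t) ≡ᵇ suc j) ≡ unit j
    tabulate-≡ᵇ {zero}  j       = refl
    tabulate-≡ᵇ {suc n} zero    = cong (true ∷_) (tabulate-≡ᵇ-0)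
      where
      tabulate-≡ᵇ-0 : ∀ {n} → tabulate {n = n} (λ t → suc (toℕ t) ≡ᵇ 0) ≡ 0ᵛ
      tabulate-≡ᵇ-0 {zero}  = refl
      tabulate-≡ᵇ-0 {suc n} = cong (false ∷_) tabulate-≡ᵇ-0
    tabulate-≡ᵇ {suc n} (suc j) = cong (false ∷_) (tabulate-≡ᵇ j)

  prod-powB-central : ∀ {k} (F : ℕ → H m) (φ : Vec Bool k → Vec Bool (suc (m ∸ 3))) →
    (∀ v w → φ (v ⊻ w) ≡ φ v ⊻ φ w) → (∀ j → j < k → F (suc j) ≡ central (φ (unit j))) →
    ∀ w → prod (tabulateᴸ (λ t → powB (F (suc (toℕ t))) (lookup w t))) ≡ central (φ w)
  prod-powB-central F φ φ-⊻ φ-unit []      = sym (cong central (additive-0 φ φ-⊻))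
  prod-powB-central F φ φ-⊻ φ-unit (b ∷ w) = begin
    powB (F 1) b · prod (tabulateᴸ (λ t → powB (F (suc (suc (toℕ t)))) (lookup w t)))
      ≡⟨ cong (powB (F 1) b ·_) (prod-powB-central (λ l → F (suc l)) (λ v → φ (false ∷ v))
           (λ v w → φ-⊻ (false ∷ v) (false ∷ w)) (λ j j<k → φ-unit (suc j) (s≤s j<k)) w) ⟩
    powB (F 1) b · central (φ (false ∷ w))
      ≡⟨ head b ⟩
    central (φ (b ∷ w)) ∎
    where
    open ≡-Reasoning
    head : ∀ b → powB (F 1) b · central (φ (false ∷ w)) ≡ central (φ (b ∷ w))
    head false = one-· _
    head true  = begin
      F 1 · central (φ (false ∷ w))                  ≡⟨ cong (_· _) (φ-unit 0 (s≤s z≤n)) ⟩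
      central (φ (unit 0)) · central (φ (false ∷ w)) ≡⟨ central-· _ _ ⟩
      central (φ (unit 0) ⊻ φ (false ∷ w))           ≡⟨ cong central (sym (φ-⊻ (unit 0) (false ∷ w))) ⟩
      central (φ (true ∷ (0ᵛ ⊻ w)))                  ≡⟨ cong (λ v → central (φ (true ∷ v))) (⊻-identityˡ w) ⟩
      central (φ (true ∷ w))                         ∎

  prod-central : ∀ {k} (F : ℕ → H m) (φ : Vec Bool k → Vec Bool (suc (m ∸ 3))) →
    (∀ v w → φ (v ⊻ w) ≡ φ v ⊻ φ w) → (∀ j → j < k → F (suc j) ≡ central (φ (unit j))) →
    ∀ w → prod (map (λ t → powB (F (suc (toℕ t))) (lookup w t)) (allFin k)) ≡ central (φ w)
  prod-central F φ φ-⊻ φ-unit w =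
    trans (cong prod (map-tabulate (λ t → t) (λ t → powB (F (suc (toℕ t))) (lookup w t))))
          (prod-powB-central F φ φ-⊻ φ-unit w)

isOdd-odd : ∀ {m} k → isOdd {m} (suc (double k)) ≡ true
isOdd-odd zero    = refl
isOdd-odd {m} (suc k) = isOdd-odd {m} k

isOdd-even : ∀ {m} k → isOdd {m} (double k) ≡ false
isOdd-even zero    = refl
isOdd-even {m} (suc k) = isOdd-even {m} k

module Generators (r : ℕ) where

  m : ℕ
  m = 4 + double r

  central-cong : ∀ {s s' v v'} → s ≡ s' → v ≡ v' → central {m} (s ∷ v) ≡ central (s' ∷ v')
  central-cong refl refl = refl

  a²-· : ∀ (v : Vec Bool (m ∸ 3)) → (a · a) · mk {m} e0 false v ≡ mk e2 false v
  a²-· v = cong (mk e2 false) (trans (cong (_⊻ v) (⊻-self 0ᵛ)) (⊻-identityˡ v))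

  xc-unit : ∀ j → j < suc (double r) → xc {m} (suc j) ≡ central (xᵃ {r} (unit j) ∷ xᶜ {r} (unit j))
  xc-unit = cpart-indices _ even odd last
    where
    even : ∀ k → k < r → xc {m} (suc (double k)) ≡ central (xᵃ {r} (unit (double k)) ∷ xᶜ {r} (unit (double k)))
    even k k<r rewrite double-≡ᵇ-< k<r | isOdd-odd {m} k =
      trans (c-unit (double k)) (central-cong (sym (xᵃ-unit-even k<r)) (sym (xᶜ-unit-even k)))
    odd : ∀ k → k < r →
          xc {m} (suc (suc (double k))) ≡ central (xᵃ {r} (unit (suc (double k))) ∷ xᶜ {r} (unit (suc (double k))))
    odd k k<r rewrite odd-≡ᵇ-double k r | isOdd-even {m} (suc k) = begin
      ((a · a) · c (suc (double k))) · c (suc (suc (double k)))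
        ≡⟨ cong₂ (λ u u' → ((a · a) · u) · u') (c-unit (double k)) (c-unit (suc (double k))) ⟩
      ((a · a) · mk e0 false (unit (double k))) · mk e0 false (unit (suc (double k)))
        ≡⟨ cong (_· mk e0 false (unit (suc (double k)))) (a²-· (unit (double k))) ⟩
      mk e2 false (unit (double k) ⊻ unit (suc (double k)))
        ≡⟨ central-cong (sym (xᵃ-unit-odd k<r)) (sym (xᶜ-unit-odd k<r)) ⟩
      central (xᵃ {r} (unit (suc (double k))) ∷ xᶜ {r} (unit (suc (double k)))) ∎
      where open ≡-Reasoning
    last : xc {m} (suc (double r)) ≡ central (xᵃ {r} (unit (double r)) ∷ xᶜ {r} (unit (double r)))
    last rewrite ≡ᵇ-refl (double r) =
      trans (cong ((a · a) ·_) (c-unit (double r)))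
        (trans (a²-· (unit (double r))) (central-cong (sym (xᵃ-unit-last {r})) (sym (xᶜ-unit-even r))))

  c₀c₀-· : ∀ (u : Vec Bool (m ∸ 3)) → (c {m} 0 · c 0) · mk e0 false u ≡ mk e0 false u
  c₀c₀-· u =
    cong (mk e0 false) (trans (cong (_⊻ u) (⊻-self (tabulate (λ t → suc (toℕ t) ≡ᵇ 0)))) (⊻-identityˡ u))

  c·c·c : ∀ i j l → (c {m} (suc i) · c (suc j)) · c (suc l) ≡ mk e0 false ((unit i ⊻ unit j) ⊻ unit l)
  c·c·c i j l = begin
    (c (suc i) · c (suc j)) · c (suc l)
      ≡⟨ cong₂ (λ u v → (u · v) · c (suc l)) (c-unit i) (c-unit j) ⟩
    (mk e0 false (unit i) · mk e0 false (unit j)) · c (suc l)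
      ≡⟨ cong ((mk e0 false (unit i) · mk e0 false (unit j)) ·_) (c-unit l) ⟩
    mk e0 false ((unit i ⊻ unit j) ⊻ unit l) ∎
    where open ≡-Reasoning

  τc-unit : ∀ j → j < suc (double r) → τc {m} (suc j) ≡ central (false ∷ τᶜ {r} (unit j))
  τc-unit = cpart-indices _ even odd last
    where
    even : ∀ k → k < r → τc {m} (suc (double k)) ≡ central (false ∷ τᶜ {r} (unit (double k)))
    even zero    0<r rewrite double-≡ᵇ-< 0<r =
      trans (cong ((c 0 · c 0) ·_) (c-unit 1))
        (trans (c₀c₀-· (unit 1)) (cong (mk e0 false) (sym (τᶜ-unit-0 0<r))))
    even (suc k) k<r rewrite double-≡ᵇ-< k<r | isOdd-odd {m} (suc k) | +-comm (double k) 1 =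
      trans (c·c·c (double k) (suc (double k)) (suc (double (suc k))))
        (cong (mk e0 false) (sym (τᶜ-unit-even k<r)))
    odd : ∀ k → k < r → τc {m} (suc (suc (double k))) ≡ central (false ∷ τᶜ {r} (unit (suc (double k))))
    odd zero    0<r rewrite odd-≡ᵇ-double 0 r =
      trans (cong ((c 0 · c 0) ·_) (c-unit 0))
        (trans (c₀c₀-· (unit 0)) (cong (mk e0 false) (sym (τᶜ-unit-1 0<r))))
    odd (suc k) k<r rewrite odd-≡ᵇ-double (suc k) r | isOdd-even {m} (suc (suc k)) =
      trans (c·c·c (double k) (suc (double k)) (double (suc k)))
        (cong (mk e0 false) (sym (τᶜ-unit-odd k<r)))
    last : τc {m} (suc (double r)) ≡ central (false ∷ τᶜ {r} (unit (double r)))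
    last rewrite ≡ᵇ-refl (double r) = trans (c-unit (double r)) (cong (mk e0 false) (sym (τᶜ-unit-last {r})))

  prod-c : ∀ (f g : ℕ → ℕ) → (∀ i → f i ≡ suc (g i)) → ∀ s →
           prod (applyUpTo (λ i → c {m} (f i)) s) ≡ mk e0 false (⊻-sum (applyUpTo (λ i → unit (g i)) s))
  prod-c f g f≡ zero    = refl
  prod-c f g f≡ (suc s) =
    cong₂ _·_ (trans (cong c (f≡ 0)) (c-unit (g 0)))
              (prod-c (λ i → f (suc i)) (λ i → g (suc i)) (λ i → f≡ (suc i)) s)

  h-nf : h {m} ≡ mk e1 false (oᶜ {r})
  h-nf = begin
    a · prod (map (λ i → c (2 * i + 1)) (upTo (suc (double r / 2))))
      ≡⟨ cong (λ n → a · prod (map (λ i → c (2 * i + 1)) (upTo (suc n)))) (double-/2 r) ⟩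
    a · prod (map (λ i → c (2 * i + 1)) (upTo (suc r)))
      ≡⟨ cong (λ l → a · prod l) (map-applyUpTo (λ i → i) (λ i → c (2 * i + 1)) (suc r)) ⟩
    a · prod (applyUpTo (λ i → c (2 * i + 1)) (suc r))
      ≡⟨ cong (a ·_) (prod-c (λ i → 2 * i + 1) double 2*+1≡suc-double (suc r)) ⟩
    mk e1 false (0ᵛ ⊻ ⊻-sum (applyUpTo (λ i → unit (double i)) (suc r)))
      ≡⟨ cong (mk e1 false) (trans (⊻-identityˡ _) oᶜ-sum) ⟩
    mk e1 false oᶜ ∎
    where open ≡-Reasoning

  xmap-prod : ∀ w → prod (map (λ t → powB (xc {m} (suc (toℕ t))) (lookup w t)) (allFin (suc (double r))))
                    ≡ mk (sq (xᵃ {r} w)) false (xᶜ w)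
  xmap-prod = prod-central xc (λ w → xᵃ {r} w ∷ xᶜ w) (λ v w → cong₂ _∷_ (xᵃ-⊻ v w) (xᶜ-⊻ v w)) xc-unit

  τmap-prod : ∀ w → prod (map (λ t → powB (τc {m} (suc (toℕ t))) (lookup w t)) (allFin (suc (double r))))
                    ≡ mk e0 false (τᶜ {r} w)
  τmap-prod = prod-central τc (λ w → false ∷ τᶜ {r} w) (λ v w → cong (false ∷_) (τᶜ-⊻ v w)) τc-unit

  powZ4-a⁻¹ : ∀ i → powZ4 (inv (a {m})) i ≡ mk (neg i) false 0ᵛ
  powZ4-a⁻¹ e0 = refl
  powZ4-a⁻¹ e1 = refl
  powZ4-a⁻¹ e2 = cong (mk e2 false) (⊻-self 0ᵛ)
  powZ4-a⁻¹ e3 = cong (mk e1 false) (⊻-zerosˡ refl refl)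

  x-mk : ∀ i j w → xmap (mk i j w) ≡ mk (neg i ⊕ ((if j then e1 else e0) ⊕ sq (xᵃ {r} w))) j (xᶜ w)
  x-mk i j w = begin
    xmap (mk i j w)
      ≡⟨ cong₂ (λ u p → u · (powB (a · b) j · p)) (powZ4-a⁻¹ i) (xmap-prod w) ⟩
    mk (neg i) false 0ᵛ · (powB (a · b) j · mk (sq (xᵃ w)) false (xᶜ w))
      ≡⟨ normalise j (xᵃ w) ⟩
    mk (neg i ⊕ ((if j then e1 else e0) ⊕ sq (xᵃ w))) j (xᶜ w) ∎
    where
    open ≡-Reasoning
    normalise : ∀ j s → mk (neg i) false 0ᵛ · (powB (a · b) j · mk (sq s) false (xᶜ w))
                 ≡ mk (neg i ⊕ ((if j then e1 else e0) ⊕ sq s)) j (xᶜ w)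
    normalise false s     = cong (mk _ false) (⊻-zerosˡ refl refl)
    normalise true  false = cong (mk _ true) (⊻-zerosˡ refl (⊻-self 0ᵛ))
    normalise true  true  = cong (mk _ true) (⊻-zerosˡ refl (⊻-self 0ᵛ))

  τmap-K : ∀ s j v → τmap {m} (mk (sq s) j v) ≡ mk (sq j) s (τᶜ {r} v)
  τmap-K s j v =
    trans (cong (λ p → powB b (isE2 {m} (sq s)) · (powB (a · a) j · p)) (τmap-prod v)) (normalise s j)
    where
    normalise : ∀ s j → powB b (isE2 {m} (sq s)) · (powB (a · a) j · mk e0 false (τᶜ v)) ≡ mk (sq j) s (τᶜ v)
    normalise false false = cong (mk e0 false) (⊻-zerosˡ refl refl)
    normalise false true  = cong (mk e2 false) (⊻-zerosˡ refl (⊻-self 0ᵛ))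
    normalise true  false = cong (mk e0 true) (⊻-zerosˡ refl refl)
    normalise true  true  = cong (mk e2 true) (⊻-zerosˡ refl (⊻-self 0ᵛ))

  y-K : ∀ s j v → ymap {m} (mk (sq s) j v) ≡ mk (sq j) s (τᶜ {r} v)
  y-K false = τmap-K false
  y-K true  = τmap-K true

  y-hK : ∀ s j w → ymap {m} (mk (e1 ⊕ sq s) j w) ≡ mk (e1 ⊕ sq j) s (τᶜ {r} w ⊻ gᶜ)
  y-hK s j w = begin
    ymap (mk (e1 ⊕ sq s) j w)
      ≡⟨ unfold s ⟩
    (h · τmap (inv h · mk (e1 ⊕ sq s) j w)) · c (suc (double r))
      ≡⟨ cong₂ (λ h' c' → (h' · τmap (inv h' · mk (e1 ⊕ sq s) j w)) · c') h-nf (c-unit (double r)) ⟩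
    (mk e1 false oᶜ · τmap (mk (e3 ⊕ (e1 ⊕ sq s)) j (oᶜ ⊻ w))) · mk e0 false (unit (double r))
      ≡⟨ cong (λ u → (mk e1 false oᶜ · u) · mk e0 false (unit (double r))) (τmap-hK s) ⟩
    mk (e1 ⊕ sq j) s (oᶜ ⊻ τᶜ (oᶜ ⊻ w)) · mk e0 false (unit (double r))
      ≡⟨ ·-c (e1 ⊕ sq j) s _ _ ⟩
    mk (e1 ⊕ sq j) s ((oᶜ ⊻ τᶜ (oᶜ ⊻ w)) ⊻ unit (double r))
      ≡⟨ cong (mk (e1 ⊕ sq j) s) (y-hK-cpart w) ⟩
    mk (e1 ⊕ sq j) s (τᶜ w ⊻ gᶜ) ∎
    where
    open ≡-Reasoning
    -- inK, hence ymap, only computes once the a-exponent is a constructor.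
    unfold : ∀ s → ymap (mk (e1 ⊕ sq s) j w) ≡ (h · τmap (inv h · mk (e1 ⊕ sq s) j w)) · c (suc (double r))
    unfold false = refl
    unfold true  = refl
    τmap-hK : ∀ s → τmap (mk (e3 ⊕ (e1 ⊕ sq s)) j (oᶜ ⊻ w)) ≡ mk (sq j) s (τᶜ (oᶜ ⊻ w))
    τmap-hK false = τmap-K false j (oᶜ ⊻ w)
    τmap-hK true  = τmap-K true j (oᶜ ⊻ w)

  zmap-nf : ∀ (u : H m) → zmap u ≡ ymap (u · mk e1 false oᶜ) · mk e3 false (oᶜ ⊻ unit (double r))
  zmap-nf u = cong₂ (λ h' c' → ymap (u · h') · (inv h' · c')) h-nf (c-unit (double r))

  z-K : ∀ s j w → zmap {m} (mk (sq s) j w) ≡ mk (sq s) (s xor j) (τᶜ {r} w)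
  z-K s j w = trans (zmap-nf (mk (sq s) j w)) (trans (step s j) (cong (mk (sq s) (s xor j)) (z-K-cpart w)))
    where
    Y : H m
    Y = mk e3 false (oᶜ ⊻ unit (double r))
    step : ∀ s j → ymap (mk (sq s) j w · mk e1 false oᶜ) · Y
                   ≡ mk (sq s) (s xor j) ((τᶜ (w ⊻ oᶜ) ⊻ gᶜ) ⊻ (oᶜ ⊻ unit (double r)))
    step false false = cong (_· Y) (y-hK false false (w ⊻ oᶜ))
    step false true  = cong (_· Y) (y-hK true  true  (w ⊻ oᶜ))
    step true  false = cong (_· Y) (y-hK true  false (w ⊻ oᶜ))
    step true  true  = cong (_· Y) (y-hK false true  (w ⊻ oᶜ))

  z-ab : ∀ w → zmap {m} (mk e1 true w) ≡ mk e1 false (τᶜ {r} w ⊻ gᶜ)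
  z-ab w = trans (zmap-nf (mk e1 true w))
    (trans (cong (_· mk e3 false (oᶜ ⊻ unit (double r))) (y-K false true (w ⊻ oᶜ)))
           (cong (mk e1 false) (z-ab-cpart w)))

-- Orbits

module Orbits (r : ℕ) where

  open Generators r
  open SetoidReasoning (setoid (Step m))
  module ~ = Setoid (setoid (Step m))

  infix 4 _~_
  _~_ : H m → H m → Set
  _~_ = SameOrbit m

  by : ∀ g {u v} → act m g u ≡ v → u ~ v
  by g eq = return (g , eq)

  ab~a : ∀ w → mk e1 true w ~ mk e1 false w
  ab~a w = begin
    mk e1 true w                     ≈⟨ by gz (z-ab w) ⟩
    mk e1 false (τᶜ w ⊻ gᶜ)          ≈⟨ by gy (y-hK false false _) ⟩
    mk e1 false (τᶜ (τᶜ w ⊻ gᶜ) ⊻ gᶜ) ≡⟨ cong (mk e1 false) (τᶜ-⊻gᶜ-involutive w) ⟩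
    mk e1 false w                    ∎

  a³~a : ∀ w → mk e3 false w ~ mk e1 false w
  a³~a w = begin
    mk e3 false w                      ≡⟨ cong (mk e3 false) (τᶜ-⊻gᶜ-involutive w) ⟨
    mk e3 false (τᶜ (τᶜ w ⊻ gᶜ) ⊻ gᶜ)  ≈⟨ by gy (y-hK false true _) ⟨
    mk e1 true (τᶜ w ⊻ gᶜ)             ≈⟨ ab~a _ ⟩
    mk e1 false (τᶜ w ⊻ gᶜ)            ≈⟨ by gy (y-hK false false _) ⟩
    mk e1 false (τᶜ (τᶜ w ⊻ gᶜ) ⊻ gᶜ)  ≡⟨ cong (mk e1 false) (τᶜ-⊻gᶜ-involutive w) ⟩
    mk e1 false w                      ∎

  a~a-xᶜ : ∀ w → mk e1 false w ~ mk e1 false (xᶜ w)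
  a~a-xᶜ w with xᵃ {r} w | x-mk e1 false w
  ... | true  | x-eq = by gx x-eq
  ... | false | x-eq = ~.trans (by gx x-eq) (a³~a (xᶜ w))

  a²~a²b : ∀ v → mk e2 false v ~ mk e2 true v
  a²~a²b v = begin
    mk e2 false v          ≈⟨ by gz (z-K true false v) ⟩
    mk e2 true (τᶜ v)      ≈⟨ by gy (y-K true true _) ⟩
    mk e2 true (τᶜ (τᶜ v)) ≡⟨ cong (mk e2 true) (τᶜ-involutive v) ⟩
    mk e2 true v           ∎

  a²~b : ∀ v → mk e2 false v ~ mk e0 true v
  a²~b v = begin
    mk e2 false v          ≈⟨ by gy (y-K true false v) ⟩
    mk e0 true (τᶜ v)      ≈⟨ by gz (z-K false true _) ⟩
    mk e0 true (τᶜ (τᶜ v)) ≡⟨ cong (mk e0 true) (τᶜ-involutive v) ⟩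
    mk e0 true v           ∎

  a²~a-xᶜ : ∀ v → mk e2 false v ~ mk e1 false (xᶜ v)
  a²~a-xᶜ v with xᵃ {r} v | x-mk e0 true v | x-mk e2 true v
  ... | true  | _    | x-eq = ~.trans (a²~a²b v) (~.trans (by gx x-eq) (ab~a (xᶜ v)))
  ... | false | x-eq | _    = ~.trans (a²~b v) (~.trans (by gx x-eq) (ab~a (xᶜ v)))

  a²~a : ∀ v → mk e2 false v ~ mk e1 false v
  a²~a v = begin
    mk e2 false v           ≈⟨ a²~a-xᶜ v ⟩
    mk e1 false (xᶜ v)      ≈⟨ a~a-xᶜ (xᶜ v) ⟩
    mk e1 false (xᶜ (xᶜ v)) ≡⟨ cong (mk e1 false) (xᶜ-involutive v) ⟩
    mk e1 false v           ∎

  a³b~a²-xᶜ : ∀ w → mk e3 true w ~ mk e2 false (xᶜ w)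
  a³b~a²-xᶜ w with xᵃ {r} (xᶜ w) | x-mk e0 true (xᶜ w) | x-mk e2 true (xᶜ w)
  ... | true  | x-eq | _    = begin
    mk e3 true w           ≡⟨ cong (mk e3 true) (xᶜ-involutive w) ⟨
    mk e3 true (xᶜ (xᶜ w)) ≈⟨ by gx x-eq ⟨
    mk e0 true (xᶜ w)      ≈⟨ a²~b (xᶜ w) ⟨
    mk e2 false (xᶜ w)     ∎
  ... | false | _    | x-eq = begin
    mk e3 true w           ≡⟨ cong (mk e3 true) (xᶜ-involutive w) ⟨
    mk e3 true (xᶜ (xᶜ w)) ≈⟨ by gx x-eq ⟨
    mk e2 true (xᶜ w)      ≈⟨ a²~a²b (xᶜ w) ⟨
    mk e2 false (xᶜ w)     ∎

  a³b~a : ∀ w → mk e3 true w ~ mk e1 false w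
  a³b~a w = begin
    mk e3 true w            ≈⟨ a³b~a²-xᶜ w ⟩
    mk e2 false (xᶜ w)      ≈⟨ a²~a-xᶜ (xᶜ w) ⟩
    mk e1 false (xᶜ (xᶜ w)) ≡⟨ cong (mk e1 false) (xᶜ-involutive w) ⟩
    mk e1 false w           ∎

  a~a-τᶜ : ∀ w → mk e1 false w ~ mk e1 false (τᶜ w)
  a~a-τᶜ w = begin
    mk e1 false w       ≈⟨ a²~a w ⟨
    mk e2 false w       ≈⟨ by gy (y-K true false w) ⟩
    mk e0 true (τᶜ w)   ≈⟨ a²~b (τᶜ w) ⟨
    mk e2 false (τᶜ w)  ≈⟨ a²~a (τᶜ w) ⟩
    mk e1 false (τᶜ w)  ∎

  IsTranslation : CPart r → Set
  IsTranslation t = ∀ w → mk e1 false w ~ mk e1 false (w ⊻ t)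

  translation-⊻ : ∀ {t t'} → IsTranslation t → IsTranslation t' → IsTranslation (t ⊻ t')
  translation-⊻ {t} {t'} T T' w = begin
    mk e1 false w              ≈⟨ T w ⟩
    mk e1 false (w ⊻ t)        ≈⟨ T' (w ⊻ t) ⟩
    mk e1 false ((w ⊻ t) ⊻ t') ≡⟨ cong (mk e1 false) (⊻-assoc w t t') ⟩
    mk e1 false (w ⊻ (t ⊻ t')) ∎

  translation-conj : (f : CPart r → CPart r) → (∀ w → mk e1 false w ~ mk e1 false (f w)) →
                     (∀ v w → f (v ⊻ w) ≡ f v ⊻ f w) → (∀ w → f (f w) ≡ w) →
                     ∀ {t} → IsTranslation t → IsTranslation (f t)
  translation-conj f a~a-f f-⊻ f-involutive {t} T w = begin
    mk e1 false w               ≈⟨ a~a-f w ⟩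
    mk e1 false (f w)           ≈⟨ T (f w) ⟩
    mk e1 false (f w ⊻ t)       ≈⟨ a~a-f (f w ⊻ t) ⟩
    mk e1 false (f (f w ⊻ t))   ≡⟨ cong (mk e1 false) (trans (f-⊻ (f w) t) (cong (_⊻ f t) (f-involutive w))) ⟩
    mk e1 false (w ⊻ f t)       ∎

  translation-gᶜ : IsTranslation gᶜ
  translation-gᶜ w = begin
    mk e1 false w                ≈⟨ by gy (y-hK false false w) ⟩
    mk e1 false (τᶜ w ⊻ gᶜ)      ≈⟨ a~a-τᶜ _ ⟩
    mk e1 false (τᶜ (τᶜ w ⊻ gᶜ)) ≡⟨ cong (mk e1 false) (τᶜ-τᶜ-⊻gᶜ w) ⟩
    mk e1 false (w ⊻ gᶜ)         ∎

  translation : ∀ t → IsTranslation t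
  translation = gᶜ-cyclic IsTranslation translation-gᶜ translation-⊻
    (translation-conj xᶜ a~a-xᶜ xᶜ-⊻ xᶜ-involutive) (translation-conj τᶜ a~a-τᶜ τᶜ-⊻ τᶜ-involutive)

  a~a : ∀ v w → mk e1 false v ~ mk e1 false w
  a~a v w = begin
    mk e1 false v             ≈⟨ translation (v ⊻ w) v ⟩
    mk e1 false (v ⊻ (v ⊻ w)) ≡⟨ cong (mk e1 false) (⊻-cancelˡ v w) ⟩
    mk e1 false w             ∎

  base : H m
  base = mk e1 false 0ᵛ

  Separating : (CPart r → Bool) → Set
  Separating φ = ∀ w → φ w ≡ true → mk e0 false w ~ base

  separating-xᵃ : Separating xᵃ
  separating-xᵃ w xᵃw≡true with xᵃ {r} w | x-mk e0 false w
  ... | true  | x-eq = ~.trans (by gx x-eq) (~.trans (a²~a _) (a~a _ _))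
  separating-xᵃ w () | false | _

  separating-∘xᶜ : ∀ {φ} → Separating φ → Separating (λ w → φ (xᶜ w))
  separating-∘xᶜ S w φxw≡true with xᵃ {r} w | x-mk e0 false w | separating-xᵃ w
  ... | true  | _    | Sx = Sx refl
  ... | false | x-eq | _  = ~.trans (by gx x-eq) (S (xᶜ w) φxw≡true)

  separating-∘τᶜ : ∀ {φ} → Separating φ → Separating (λ w → φ (τᶜ w))
  separating-∘τᶜ S w φτw≡true = ~.trans (by gy (y-K false false w)) (S (τᶜ w) φτw≡true)

  separating-xor : ∀ {φ ψ} → Separating φ → Separating ψ → Separating (λ w → φ w xor ψ w)
  separating-xor {φ} Sφ Sψ w φ⊕ψ≡true with φ w in φw
  ... | true  = Sφ w φw
  ... | false = Sψ w φ⊕ψ≡true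

  separating-ext : ∀ {φ ψ} → (∀ w → φ w ≡ ψ w) → Separating φ → Separating ψ
  separating-ext φ≗ψ S w ψw≡true = S w (trans (φ≗ψ w) ψw≡true)

  c~base : ∀ w → w ≢ 0ᵛ → mk e0 false w ~ base
  c~base w w≢0 with xᵃ-separates Separating separating-xᵃ separating-xor separating-∘xᶜ separating-∘τᶜ
                                  separating-ext w w≢0
  ... | φ , Sφ , φw≡true = Sφ w φw≡true

  ~base : ∀ u → u ≢ one → u ~ base
  ~base (mk e0 false w) u≢1 = c~base w (λ w≡0 → u≢1 (cong (mk e0 false) w≡0))
  ~base (mk e0 true  w) _   = ~.trans (~.sym (a²~b w)) (~.trans (a²~a w) (a~a w 0ᵛ))
  ~base (mk e1 false w) _   = a~a w 0ᵛ
  ~base (mk e1 true  w) _   = ~.trans (ab~a w) (a~a w 0ᵛ)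
  ~base (mk e2 false w) _   = ~.trans (a²~a w) (a~a w 0ᵛ)
  ~base (mk e2 true  w) _   = ~.trans (~.sym (a²~a²b w)) (~.trans (a²~a w) (a~a w 0ᵛ))
  ~base (mk e3 false w) _   = ~.trans (a³~a w) (a~a w 0ᵛ)
  ~base (mk e3 true  w) _   = ~.trans (a³b~a w) (a~a w 0ᵛ)

  transitive : ∀ u v → u ≢ one → v ≢ one → u ~ v
  transitive u v u≢1 v≢1 = ~.trans (~base u u≢1) (~.sym (~base v v≢1))

even-≥4 : ∀ {m} → 4 ≤ m → 2 ∣ m → ∃[ r ] m ≡ 4 + double r
even-≥4 {.0} ()                (divides zero          refl)
even-≥4 {.2} (s≤s (s≤s ()))    (divides (suc zero)    refl)
even-≥4      _                 (divides (suc (suc r)) refl) = r , cong (4 +_) (sym (double-*2 r))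

lemma3p11 : (m : ℕ) → 4 ≤ m → 2 ∣ m →
    (u v : H m) → u ≢ one {m} → v ≢ one {m} → SameOrbit m u v
lemma3p11 m 4≤m 2∣m with even-≥4 4≤m 2∣m
... | r , refl = Orbits.transitive r
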